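{- Let $n\ge1$ and let $(P_n,\sigma)$ be any signed graph whose underlying graph is the path $P_n$ on $n$ vertices. Then $$\psi(P_n,\sigma)=\max\Big(\{2x : x\in\mathbb{Z}_{\ge0},\ x^2\le n-1\}\cup\{2x+1 : x\in\mathbb{Z}_{\ge0},\ (x+1)^2-1\le n-1\}\Big).$$
   Context: A signed graph $(G,\sigma)$ is a finite simple graph $G$ with a signature $\sigma:E(G)\to\{ -,+\}$. Switching a set $S\subseteq V(G)$ changes the sign of every edge with exactly one end in $S$; two signed graphs on the same underlying graph are equivalent if one is obtained from the other by switching some set of vertices. For $k\ge1$ let $M_k=\{ -n,\dots,-1,+1,\dots,+n\}$ if $k=2n$, and $M_k=\{ -n,\dots,-1,\pm0,+1,\dots,+n\}$ if $k=2n+1$, where $\pm0$ is a single colour with $-(\pm0)=\pm0$. A $k$-colouring of $(G,\sigma)$ is a map $\phi:V(G)\to M_k$. Let $K_k^*$ be the signed multigraph with vertex set $\{i\ge 0: +i\in M_k\}$ (vertex $0$ standing for colour $\pm0$ when $k$ is odd), in which every two distinct vertices are joined by exactly one positive and one negative edge, and every vertex $i\neq0$ carries exactly one negative loop. Given a $k$-colouring $\phi$, the reduced signed graph $R(G,\sigma,\phi)$ is obtained by (1) switching every vertex with a negative colour $-i$ and recolouring it $+i$; (2) identifying, for each $i$, all vertices of colour $+i$ (resp. $\pm0$) into a single vertex $i$ (resp. $0$), edges inside a class becoming loops; (3) keeping at most one positive and at most one negative edge (or loop) between any two vertices (or at any vertex). The colouring $\phi$ is complete if $R(G,\sigma,\phi)$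 is exactly $K_k^*$. The achromatic number $\psi(G,\sigma)$ is the largest $k\ge1$ such that some signed graph equivalent to $(G,\sigma)$ admits a complete $k$-colouring. -}

module Defs where

open import Data.Nat using (ℕ; zero; suc; _+_; _*_; _∸_; _≤_)
open import Data.Bool using (Bool; true; false; _xor_)
open import Data.Fin using (Fin; inject₁) renaming (suc to fsuc)
open import Data.Product using (Σ; ∃; _×_; _,_)
open import Data.Sum using (_⊎_)
open import Relation.Binary.PropositionalEquality using (_≡_; _≢_)

-- Signs: false = positive (+), true = negative (-).
-- Multiplication of signs is xor.
Sign : Set
Sign = Bool

-- The path P_n with n = suc m vertices: vertices are Fin (suc m),
-- edges are indexed by Fin m, edge i joining vertices i and i+1.
left right : {m : ℕ} → Fin m → Fin (suc m)
left i = inject₁ i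
right i = fsuc i

PathSignature : ℕ → Set
PathSignature m = Fin m → Sign

switch : {m : ℕ} → (Fin (suc m) → Bool) → PathSignature m → PathSignature m
switch S σ i = σ i xor (S (left i) xor S (right i))

Equivalent : {m : ℕ} → PathSignature m → PathSignature m → Set
Equivalent {m} σ τ = Σ (Fin (suc m) → Bool) λ S → ∀ i → τ i ≡ switch S σ i

Odd : ℕ → Set
Odd k = ∃ λ t → k ≡ 2 * t + 1

-- Vertices of K_k^*: magnitudes j with +j ∈ M_k (j = 0 standing for ±0).
KVertex : ℕ → ℕ → Set
KVertex k j = (1 ≤ j × 2 * j ≤ k) ⊎ (j ≡ 0 × Odd k)

-- A colour: magnitude and sign; (j , false) is +j, (j , true) is -j,
-- and (0 , false) is ±0.
record Colour : Set where
  constructor col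
  field
    mag : ℕ
    neg : Bool
open Colour public

-- Membership in M_k (±0 has a single representation (0 , false)).
InM : ℕ → Colour → Set
InM k c = KVertex k (mag c) × (mag c ≡ 0 → neg c ≡ false)

-- Sign of edge i in the reduced graph, after switching all negatively
-- coloured vertices (τ is the signature being coloured).
redSign : {m : ℕ} → PathSignature m → (Fin (suc m) → Colour) → Fin m → Sign
redSign τ φ i = τ i xor (neg (φ (left i)) xor neg (φ (right i)))

-- φ is a complete k-colouring of (P_(suc m), τ): R(P, τ, φ) is exactly K_k^*.
Complete : {m : ℕ} → ℕ → PathSignature m → (Fin (suc m) → Colour) → Set
Complete {m} k τ φ =
  (∀ v → InM k (φ v))
  -- every vertex of K_k^* is a vertex of R
  × (∀ j → KVertex k j → ∃ λ v → mag (φ v) ≡ j)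
  -- R has no loops other than negative loops at vertices j ≠ 0
  × (∀ i → mag (φ (left i)) ≡ mag (φ (right i)) →
        mag (φ (left i)) ≢ 0 × redSign τ φ i ≡ true)
  -- between distinct vertices of K_k^* there is an edge of each sign
  × (∀ a b → KVertex k a → KVertex k b → a ≢ b → ∀ (s : Sign) →
        ∃ λ i → ((mag (φ (left i)) ≡ a × mag (φ (right i)) ≡ b)
                 ⊎ (mag (φ (left i)) ≡ b × mag (φ (right i)) ≡ a))
                × redSign τ φ i ≡ s)
  -- every vertex j ≠ 0 of K_k^* carries a negative loop
  × (∀ a → KVertex k a → a ≢ 0 →
        ∃ λ i → mag (φ (left i)) ≡ a × mag (φ (right i)) ≡ a
                × redSign τ φ i ≡ true)

Achievable : {m : ℕ} → PathSignature m → ℕ → Set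
Achievable {m} σ k = Σ (PathSignature m) λ τ → Equivalent σ τ ×
                       Σ (Fin (suc m) → Colour) λ φ → Complete k τ φ

IsLargest : (ℕ → Set) → ℕ → Set
IsLargest P k = P k × (∀ k' → P k' → k' ≤ k)

AchromaticNumberIs : {m : ℕ} → PathSignature m → ℕ → Set
AchromaticNumberIs σ = IsLargest (λ k → 1 ≤ k × Achievable σ k)

FormulaSet : ℕ → ℕ → Set
FormulaSet n k = (∃ λ x → k ≡ 2 * x × x * x ≤ n ∸ 1)
               ⊎ (∃ λ x → k ≡ 2 * x + 1 × (x + 1) * (x + 1) ∸ 1 ≤ n ∸ 1)

module Submission where

open import Defs
open import Data.Nat using (ℕ; suc)

open import Data.Bool using (Bool; true; false; not; _xor_; if_then_else_)
import Data.Bool.Properties as Bool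
open import Data.Bool.Properties using (xor-assoc; xor-same; xor-identityʳ; not-distribˡ-xor; ¬-not)
open import Data.Fin using (Fin; toℕ; fromℕ<; inject₁; remQuot; combine)
  renaming (zero to fzero; suc to fsuc)
open import Data.Fin.Properties
  using (toℕ-injective; toℕ-inject₁; toℕ-fromℕ<; toℕ<n; combine-remQuot; injective⇒≤)
open import Data.List using (List; []; _∷_; length; applyUpTo)
open import Data.List.Properties using (length-applyUpTo)
open import Data.List.Membership.Propositional using (_∈_)
open import Data.List.Membership.Propositional.Properties using (∈-applyUpTo⁺)
open import Data.List.Relation.Unary.All using (All; []; _∷_)
import Data.List.Relation.Unary.All as All
open import Data.List.Relation.Unary.All.Properties using (applyUpTo⁺₁)
open import Data.List.Relation.Unary.Any using (here; there)
open import Data.List.Relation.Unary.Linked using (Linked; []; [-]; _∷_)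
open import Data.Nat using (zero; _+_; _*_; _∸_; _≤_; _<_; z≤n; s≤s; s≤s⁻¹; _≤?_; _≟_; pred)
open import Data.Nat.Properties
open import Data.Nat.Tactic.RingSolver using (solve-∀)
open import Data.Product using (∃; _×_; _,_; proj₁; proj₂; uncurry)
import Data.Product as Product
open import Data.Product.Properties using (,-injectiveˡ; ,-injectiveʳ)
open import Data.Sum using (_⊎_; inj₁; inj₂; [_,_])
import Data.Vec.Functional as Vector
open import Function using (_∘_; id; flip)
open import Function.Definitions using (Injective)
open import Relation.Nullary using (yes; no; does; contradiction)
open import Relation.Nullary.Decidable using (dec-true; dec-false)
open import Relation.Binary.PropositionalEquality hiding ([_])

-- The arcs of K_k^*, the ordered pairs (a , b) of its vertices other than (0 , 0), are in
-- bijection with its edges: (a , b) names the positive edge ab if a < b, the negative edge ab if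
-- a > b and the negative loop at a if a = b. There are x² arcs for k = 2x and (x + 1)² − 1 for
-- k = 2x + 1. In a complete colouring every edge of K_k^* is the image of a path edge, so the m
-- edges of the path name every arc, which bounds k. Conversely, all signatures of a path are
-- switching equivalent, so it suffices to lay along the path, with positive colours, a walk of
-- K_k^* that traverses every arc, and to give each path edge the sign its arc names. Such walks
-- with x² + 1, resp. (x + 1)², vertices are built by adding one vertex h at a time through a
-- star 1 h 2 h … h n h around it.

xor-cancelˡ : ∀ a b → a xor (a xor b) ≡ b
xor-cancelˡ a b = trans (sym (xor-assoc a a b)) (cong (_xor b) (xor-same a))

xor-cancelʳ : ∀ a b → (a xor b) xor b ≡ a
xor-cancelʳ a b = trans (xor-assoc a b b) (trans (cong (a xor_) (xor-same b)) (xor-identityʳ a))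

does-≤?-swap : ∀ {a b} → a ≢ b → does (a ≤? b) ≡ not (does (b ≤? a))
does-≤?-swap {a} {b} a≢b with ≤-total a b
... | inj₁ a≤b =
  trans (dec-true (a ≤? b) a≤b) (cong not (sym (dec-false (b ≤? a) (a≢b ∘ ≤-antisym a≤b))))
... | inj₂ b≤a =
  trans (dec-false (a ≤? b) (a≢b ∘ flip ≤-antisym b≤a)) (cong not (sym (dec-true (b ≤? a) b≤a)))

even-or-odd : ∀ k → ∃ λ x → k ≡ 2 * x ⊎ k ≡ 2 * x + 1
even-or-odd zero = 0 , inj₁ refl
even-or-odd (suc k) with even-or-odd k
... | x , inj₁ refl = x , inj₂ (+-comm 1 (2 * x))
... | x , inj₂ refl = suc x , inj₁ (trans (cong suc (+-comm (2 * x) 1)) (sym (*-suc 2 x)))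

injective-into-image⇒≤ : ∀ {A : Set} {m n} (f : Fin m → A) (g : Fin n → A) →
                         Injective _≡_ _≡_ g → (∀ c → ∃ λ i → f i ≡ g c) → n ≤ m
injective-into-image⇒≤ f g g-injective preimage =
  injective⇒≤ {f = proj₁ ∘ preimage} λ {c} {c′} eq → g-injective (begin
    g c                      ≡⟨ proj₂ (preimage c) ⟨
    f (proj₁ (preimage c))   ≡⟨ cong f eq ⟩
    f (proj₁ (preimage c′))  ≡⟨ proj₂ (preimage c′) ⟩
    g c′                     ∎)
  where open ≡-Reasoning

square-covered⇒≤ : ∀ {m} n (f : Fin m → ℕ × ℕ) →
                   (∀ {a b} → a < n → b < n → ∃ λ i → f i ≡ (a , b)) → n * n ≤ m
square-covered⇒≤ n f covered =
  injective-into-image⇒≤ f pair pair-injective (λ c → covered (toℕ<n _) (toℕ<n _))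
  where
  pair : Fin (n * n) → ℕ × ℕ
  pair c = Product.map toℕ toℕ (remQuot {n} n c)
  pair-injective : Injective _≡_ _≡_ pair
  pair-injective {c} {c′} eq = begin
    c                                   ≡⟨ combine-remQuot {n} n c ⟨
    uncurry combine (remQuot {n} n c)   ≡⟨ cong (uncurry combine) (cong₂ _,_ (toℕ-injective (,-injectiveˡ eq))
                                                                            (toℕ-injective (,-injectiveʳ eq))) ⟩
    uncurry combine (remQuot {n} n c′)  ≡⟨ combine-remQuot {n} n c′ ⟩
    c′                                  ∎
    where open ≡-Reasoning

KVertex-even⁺ : ∀ {x a} → 1 ≤ a → a ≤ x → KVertex (2 * x) a
KVertex-even⁺ 1≤a a≤x = inj₁ (1≤a , *-monoʳ-≤ 2 a≤x)

KVertex-even⁻ : ∀ {x a} → KVertex (2 * x) a → 1 ≤ a × a ≤ x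
KVertex-even⁻ (inj₁ (1≤a , 2a≤2x)) = 1≤a , *-cancelˡ-≤ 2 2a≤2x
KVertex-even⁻ {x} (inj₂ (_ , t , 2x≡2t+1)) =
  contradiction (trans 2x≡2t+1 (+-comm (2 * t) 1)) (even≢odd x t)

KVertex-odd⁺ : ∀ {x a} → a ≤ x → KVertex (2 * x + 1) a
KVertex-odd⁺ {x} {zero}  _   = inj₂ (refl , x , refl)
KVertex-odd⁺ {x} {suc a} a≤x = inj₁ (s≤s z≤n , ≤-trans (*-monoʳ-≤ 2 a≤x) (m≤m+n (2 * x) 1))

KVertex-odd⁻ : ∀ {x a} → KVertex (2 * x + 1) a → a ≤ x
KVertex-odd⁻ (inj₂ (refl , _)) = z≤n
KVertex-odd⁻ {x} {a} (inj₁ (_ , 2a≤2x+1)) =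
  *-cancelˡ-≤ 2 (m<1+n⇒m≤n (≤∧≢⇒< 2a≤1+2x (even≢odd a x)))
  where
  2a≤1+2x : 2 * a ≤ suc (2 * x)
  2a≤1+2x = subst (2 * a ≤_) (+-comm (2 * x) 1) 2a≤2x+1

NotBothZero : ℕ → ℕ → Set
NotBothZero a b = a ≢ 0 ⊎ b ≢ 0

NotBothZero-diagonal : ∀ {a} → NotBothZero a a → a ≢ 0
NotBothZero-diagonal = [ id , id ]

≢⇒NotBothZero : ∀ {a b} → a ≢ b → NotBothZero a b
≢⇒NotBothZero {zero}  a≢b = inj₂ (a≢b ∘ sym)
≢⇒NotBothZero {suc a} _   = inj₁ λ ()

-- The edge of K_k^* named by the arc (a , b) has sign does (b ≤? a).
Arc : ℕ → ℕ → ℕ → Set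
Arc k a b = KVertex k a × KVertex k b × NotBothZero a b

-- Path edges name arcs: the upper bound

-- The arc naming the edge of sign s between colours l and r.
code : Sign → ℕ → ℕ → ℕ × ℕ
code s l r = if s xor does (r ≤? l) then (r , l) else (l , r)

code-agrees : ∀ {s l r} → s ≡ does (r ≤? l) → code s l r ≡ (l , r)
code-agrees {l = l} {r} refl = cong (if_then (r , l) else (l , r)) (xor-same (does (r ≤? l)))

code-disagrees : ∀ {s l r} → s ≡ not (does (r ≤? l)) → code s l r ≡ (r , l)
code-disagrees {l = l} {r} refl = cong (if_then (r , l) else (l , r)) (not-xor-self (does (r ≤? l)))
  where
  not-xor-self : ∀ x → not x xor x ≡ true
  not-xor-self x = trans (sym (not-distribˡ-xor x x)) (cong not (xor-same x))

edgeArc : ∀ {m} → PathSignature m → (Fin (suc m) → Colour) → Fin m → ℕ × ℕ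
edgeArc τ φ i = code (redSign τ φ i) (mag (φ (left i))) (mag (φ (right i)))

edgeArc-≡ : ∀ {m} (τ : PathSignature m) φ i {l r} →
            mag (φ (left i)) ≡ l → mag (φ (right i)) ≡ r → edgeArc τ φ i ≡ code (redSign τ φ i) l r
edgeArc-≡ τ φ i refl refl = refl

complete⇒arc-traversed : ∀ {m k} (τ : PathSignature m) φ → Complete k τ φ →
                         ∀ {a b} → Arc k a b → ∃ λ i → edgeArc τ φ i ≡ (a , b)
complete⇒arc-traversed τ φ (_ , _ , _ , edges , loops) {a} {b} (ka , kb , nz) with a ≟ b
... | yes refl =
  let i , l≡a , r≡a , negative = loops a ka (NotBothZero-diagonal nz)
  in i , trans (edgeArc-≡ τ φ i l≡a r≡a)
                (code-agrees (trans negative (sym (dec-true (a ≤? a) ≤-refl))))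
... | no a≢b with edges a b ka kb a≢b (does (b ≤? a))
...   | i , inj₁ (l≡a , r≡b) , s≡ = i , trans (edgeArc-≡ τ φ i l≡a r≡b) (code-agrees s≡)
...   | i , inj₂ (l≡b , r≡a) , s≡ =
  i , trans (edgeArc-≡ τ φ i l≡b r≡a) (code-disagrees (trans s≡ (does-≤?-swap (a≢b ∘ sym))))

complete⇒FormulaSet : ∀ {m k} (τ : PathSignature m) φ → Complete k τ φ → FormulaSet (suc m) k
complete⇒FormulaSet {m} {k} τ φ complete with even-or-odd k
... | x , inj₁ refl =
  inj₁ (x , refl , square-covered⇒≤ x (Product.map pred pred ∘ edgeArc τ φ) arcs)
  where
  arcs : ∀ {a b} → a < x → b < x → ∃ λ i → Product.map pred pred (edgeArc τ φ i) ≡ (a , b)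
  arcs a<x b<x =
    let i , traversed = complete⇒arc-traversed τ φ complete
          (KVertex-even⁺ {x} (s≤s z≤n) a<x , KVertex-even⁺ {x} (s≤s z≤n) b<x , inj₁ λ ())
    in i , cong (Product.map pred pred) traversed
... | x , inj₂ refl =
  inj₂ (x , refl , ∸-monoˡ-≤ 1 (subst (_≤ suc m) (cong (λ y → y * y) (+-comm 1 x))
                                 (square-covered⇒≤ (suc x) ((0 , 0) Vector.∷ edgeArc τ φ) arcs-or-00)))
  where
  -- The dummy entry (0 , 0) lets all (x + 1)² pairs be counted against m + 1 entries.
  arcs-or-00 : ∀ {a b} → a < suc x → b < suc x →
               ∃ λ j → ((0 , 0) Vector.∷ edgeArc τ φ) j ≡ (a , b)
  arcs-or-00 {zero} {zero} _ _ = fzero , refl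
  arcs-or-00 {suc a} a<x b<x = Product.map fsuc id (complete⇒arc-traversed τ φ complete
    (KVertex-odd⁺ {x} (s≤s⁻¹ a<x) , KVertex-odd⁺ {x} (s≤s⁻¹ b<x) , inj₁ λ ()))
  arcs-or-00 {zero} {suc b} a<x b<x = Product.map fsuc id (complete⇒arc-traversed τ φ complete
    (KVertex-odd⁺ {x} z≤n , KVertex-odd⁺ {x} (s≤s⁻¹ b<x) , inj₂ λ ()))

-- Walks laid along the path: the lower bound

path-signatures-equivalent : ∀ {m} (σ τ : PathSignature m) → Equivalent σ τ
path-signatures-equivalent {zero} σ τ = (λ _ → false) , λ ()
path-signatures-equivalent {suc m} σ τ = S₀ Vector.∷ S , switched
  where
  rest : Equivalent (σ ∘ fsuc) (τ ∘ fsuc)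
  rest = path-signatures-equivalent (σ ∘ fsuc) (τ ∘ fsuc)
  S : Fin (suc m) → Bool
  S = proj₁ rest
  S₀ : Bool
  S₀ = (σ fzero xor τ fzero) xor S fzero
  switched : ∀ i → τ i ≡ switch (S₀ Vector.∷ S) σ i
  switched fzero = sym (trans (cong (σ fzero xor_) (xor-cancelʳ _ (S fzero)))
                              (xor-cancelˡ (σ fzero) (τ fzero)))
  switched (fsuc i) = proj₂ rest i

-- Path vertices beyond the end of the list get the padding colour 1.
at : List ℕ → ℕ → ℕ
at []      _       = 1
at (a ∷ _) zero    = a
at (_ ∷ L) (suc p) = at L p

data Consecutive (a b : ℕ) : List ℕ → Set where
  here  : ∀ {L} → Consecutive a b (a ∷ b ∷ L)
  there : ∀ {c L} → Consecutive a b L → Consecutive a b (c ∷ L)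

Consecutive⇒at : ∀ {a b L} → Consecutive a b L →
                 ∃ λ p → suc p < length L × at L p ≡ a × at L (suc p) ≡ b
Consecutive⇒at here = 0 , s≤s (s≤s z≤n) , refl , refl
Consecutive⇒at (there c) =
  let p , p<len , at-p , at-sp = Consecutive⇒at c in suc p , s≤s p<len , at-p , at-sp

All-at : ∀ {P : ℕ → Set} {L} → P 1 → All P L → ∀ p → P (at L p)
All-at P1 []         _       = P1
All-at P1 (Pa ∷ _)   zero    = Pa
All-at P1 (_  ∷ PL)  (suc p) = All-at P1 PL p

Linked-at : ∀ {R : ℕ → ℕ → Set} {L} → (∀ a → R a 1) → Linked R L →
            ∀ p → R (at L p) (at L (suc p))
Linked-at R-1 []         _       = R-1 1
Linked-at R-1 [-]        zero    = R-1 _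
Linked-at R-1 [-]        (suc _) = R-1 1
Linked-at R-1 (Rab ∷ _)  zero    = Rab
Linked-at R-1 (_   ∷ RL) (suc p) = Linked-at R-1 RL p

record ArcWalk (k : ℕ) (L : List ℕ) : Set where
  field
    vertices  : All (KVertex k) L
    avoids-00 : Linked NotBothZero L
    traverses : ∀ {a b} → Arc k a b → Consecutive a b L

module WalkColouring {m k : ℕ} {L : List ℕ} (1-vertex : KVertex k 1) (walk : ArcWalk k L)
                     (fits : length L ≤ suc m) where
  open ArcWalk walk

  φ : Fin (suc m) → Colour
  φ v = col (at L (toℕ v)) false

  -- Each edge gets the sign of the edge of K_k^* named by the arc it traverses.
  τ : PathSignature m
  τ i = does (mag (φ (right i)) ≤? mag (φ (left i)))

  redSign≡τ : ∀ i → redSign τ φ i ≡ τ i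
  redSign≡τ i = xor-identityʳ (τ i)

  left-colour : ∀ i → mag (φ (left i)) ≡ at L (toℕ i)
  left-colour i = cong (at L) (toℕ-inject₁ i)

  edge-at : ∀ {a b} p → suc p < length L → at L p ≡ a → at L (suc p) ≡ b →
            ∃ λ i → mag (φ (left i)) ≡ a × mag (φ (right i)) ≡ b × redSign τ φ i ≡ does (b ≤? a)
  edge-at {a} {b} p sp<len at-p at-sp =
    i , l≡a , r≡b , trans (redSign≡τ i) (cong₂ (λ l r → does (r ≤? l)) l≡a r≡b)
    where
    p<m : p < m
    p<m = s≤s⁻¹ (≤-trans sp<len fits)
    i : Fin m
    i = fromℕ< p<m
    l≡a : mag (φ (left i)) ≡ a
    l≡a = trans (left-colour i) (trans (cong (at L) (toℕ-fromℕ< p<m)) at-p)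
    r≡b : mag (φ (right i)) ≡ b
    r≡b = trans (cong (at L ∘ suc) (toℕ-fromℕ< p<m)) at-sp

  edge-traversing : ∀ {a b} → Arc k a b →
    ∃ λ i → mag (φ (left i)) ≡ a × mag (φ (right i)) ≡ b × redSign τ φ i ≡ does (b ≤? a)
  edge-traversing arc =
    let p , sp<len , at-p , at-sp = Consecutive⇒at (traverses arc) in edge-at p sp<len at-p at-sp

  complete : Complete k τ φ
  complete = colouring , onto , loops-negative-nonzero , both-signs , negative-loops
    where
    colouring : ∀ v → InM k (φ v)
    colouring v = All-at 1-vertex vertices (toℕ v) , λ _ → refl

    onto : ∀ j → KVertex k j → ∃ λ v → mag (φ v) ≡ j
    onto j kj = let i , l≡j , _ = edge-traversing (kj , 1-vertex , inj₂ λ ()) in left i , l≡j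

    loops-negative-nonzero : ∀ i → mag (φ (left i)) ≡ mag (φ (right i)) →
                             mag (φ (left i)) ≢ 0 × redSign τ φ i ≡ true
    loops-negative-nonzero i l≡r =
      [ (λ at≢0 → at≢0 ∘ trans (sym (left-colour i))) , (λ r≢0 → r≢0 ∘ trans (sym l≡r)) ]
        (Linked-at (λ _ → inj₂ λ ()) avoids-00 (toℕ i)) ,
      trans (redSign≡τ i) (dec-true (_ ≤? _) (≤-reflexive (sym l≡r)))

    both-signs : ∀ a b → KVertex k a → KVertex k b → a ≢ b → ∀ (s : Sign) →
      ∃ λ i → ((mag (φ (left i)) ≡ a × mag (φ (right i)) ≡ b)
               ⊎ (mag (φ (left i)) ≡ b × mag (φ (right i)) ≡ a))
              × redSign τ φ i ≡ s
    both-signs a b ka kb a≢b s with s Bool.≟ does (b ≤? a)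
    ... | yes refl = let i , l≡a , r≡b , sign = edge-traversing (ka , kb , ≢⇒NotBothZero a≢b)
                     in i , inj₁ (l≡a , r≡b) , sign
    ... | no s≢ = let i , l≡b , r≡a , sign = edge-traversing (kb , ka , ≢⇒NotBothZero (a≢b ∘ sym))
                  in i , inj₂ (l≡b , r≡a) , trans sign (trans (does-≤?-swap a≢b) (sym (¬-not s≢)))

    negative-loops : ∀ a → KVertex k a → a ≢ 0 →
      ∃ λ i → mag (φ (left i)) ≡ a × mag (φ (right i)) ≡ a × redSign τ φ i ≡ true
    negative-loops a ka a≢0 = let i , l≡a , r≡a , sign = edge-traversing (ka , ka , inj₁ a≢0)
                              in i , l≡a , r≡a , trans sign (dec-true (a ≤? a) ≤-refl)

arcWalk⇒achievable : ∀ {m k L} → KVertex k 1 → ArcWalk k L → length L ≤ suc m →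
                     (σ : PathSignature m) → Achievable σ k
arcWalk⇒achievable 1-vertex walk fits σ =
  τ , path-signatures-equivalent σ τ , φ , complete
  where open WalkColouring 1-vertex walk fits

spokes : ℕ → List ℕ → List ℕ → List ℕ
spokes h []       w = w
spokes h (a ∷ as) w = a ∷ h ∷ spokes h as w

spokes-end : ∀ {h c w} as → Consecutive h c (h ∷ spokes h as (c ∷ w))
spokes-end []       = here
spokes-end (_ ∷ as) = there (there (spokes-end as))

spokes-spoke : ∀ {h a as w} → a ∈ as →
               Consecutive h a (h ∷ spokes h as w) × Consecutive a h (h ∷ spokes h as w)
spokes-spoke (here refl)  = here , there here
spokes-spoke (there a∈as) =
  let ha , ah = spokes-spoke a∈as in there (there ha) , there (there ah)

spokes-rest : ∀ {h a b w} as → Consecutive a b w → Consecutive a b (spokes h as w)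
spokes-rest []       ab = ab
spokes-rest (_ ∷ as) ab = there (there (spokes-rest as ab))

length-spokes : ∀ h as w → length (spokes h as w) ≡ length as * 2 + length w
length-spokes h []       w = refl
length-spokes h (_ ∷ as) w = cong (2 +_) (length-spokes h as w)

All-spokes : ∀ {P : ℕ → Set} {h as w} → P h → All P as → All P w → All P (spokes h as w)
All-spokes Ph []         Pw = Pw
All-spokes Ph (Pa ∷ Pas) Pw = Pa ∷ Ph ∷ All-spokes Ph Pas Pw

Linked-spokes : ∀ {h as c w} → All (_≢ 0) as → c ≢ 0 → Linked NotBothZero (c ∷ w) →
                Linked NotBothZero (h ∷ spokes h as (c ∷ w))
Linked-spokes []             c≢0 Lcw = inj₂ c≢0 ∷ Lcw
Linked-spokes (a≢0 ∷ as≢0) c≢0 Lcw = inj₂ a≢0 ∷ inj₁ a≢0 ∷ Linked-spokes as≢0 c≢0 Lcw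

nonzero⇒Linked : ∀ {L} → All (_≢ 0) L → Linked NotBothZero L
nonzero⇒Linked []              = []
nonzero⇒Linked (_ ∷ [])        = [-]
nonzero⇒Linked (a≢0 ∷ b≢0 ∷ L≢0) = inj₁ a≢0 ∷ nonzero⇒Linked (b≢0 ∷ L≢0)

range₂ : ℕ → List ℕ
range₂ g = applyUpTo (2 +_) g

range₂-bounds : ∀ g → All (λ a → 2 ≤ a × a ≤ suc g) (range₂ g)
range₂-bounds g = applyUpTo⁺₁ (2 +_) g λ {i} i<g → m≤m+n 2 i , s≤s i<g

∈-range₂ : ∀ {a g} → 2 ≤ a → a ≤ suc g → a ∈ range₂ g
∈-range₂ {a} {g} 2≤a a≤1+g =
  subst (_∈ range₂ g) (m+[n∸m]≡n 2≤a)
        (∈-applyUpTo⁺ (2 +_) (s≤s⁻¹ (subst (_≤ suc g) (sym (m+[n∸m]≡n 2≤a)) a≤1+g)))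

star : ℕ → ℕ → List ℕ → List ℕ
star h g w = 1 ∷ h ∷ spokes h (range₂ g) w

star-in : ∀ {h g w a} → 1 ≤ a → a ≤ suc g → Consecutive a h (star h g w)
star-in {a = suc zero}    _ _ = here
star-in {a = suc (suc _)} _ a≤1+g = there (proj₂ (spokes-spoke (∈-range₂ (s≤s (s≤s z≤n)) a≤1+g)))

star-out : ∀ {h g w b} → 2 ≤ b → b ≤ suc g → Consecutive h b (star h g w)
star-out 2≤b b≤1+g = there (proj₁ (spokes-spoke (∈-range₂ 2≤b b≤1+g)))

star-rest : ∀ {h g w a b} → Consecutive a b w → Consecutive a b (star h g w)
star-rest {g = g} ab = there (there (spokes-rest (range₂ g) ab))

-- 1 ∷ tour g is a closed walk at 1 traversing each arc (a , b) with 1 ≤ a , b ≤ g + 1 once.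
tour : ℕ → List ℕ
tour zero    = 1 ∷ []
tour (suc g) = 2 + g ∷ spokes (2 + g) (range₂ g) (2 + g ∷ 1 ∷ tour g)

oddWalk : ℕ → List ℕ
oddWalk g = star 0 g (1 ∷ tour g)

tour-traverses : ∀ g {a b} → 1 ≤ a → a ≤ suc g → 1 ≤ b → b ≤ suc g → Consecutive a b (1 ∷ tour g)
tour-traverses zero (s≤s z≤n) (s≤s z≤n) (s≤s z≤n) (s≤s z≤n) = here
tour-traverses (suc g) 1≤a a≤h 1≤b b≤h with m≤n⇒m<n∨m≡n a≤h | m≤n⇒m<n∨m≡n b≤h
... | inj₁ a<h  | inj₁ b<h  = star-rest (there (tour-traverses g 1≤a (s≤s⁻¹ a<h) 1≤b (s≤s⁻¹ b<h)))
... | inj₁ a<h  | inj₂ refl = star-in 1≤a (s≤s⁻¹ a<h)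
... | inj₂ refl | inj₂ refl = there (spokes-end (range₂ g))
... | inj₂ refl | inj₁ b<h with m≤n⇒m<n∨m≡n 1≤b
...   | inj₂ refl = star-rest here
...   | inj₁ 1<b  = star-out 1<b (s≤s⁻¹ b<h)

oddWalk-traverses : ∀ g {a b} → a ≤ suc g → b ≤ suc g → NotBothZero a b → Consecutive a b (oddWalk g)
oddWalk-traverses g {zero}  {zero}        _   _   nz = contradiction refl (NotBothZero-diagonal nz)
oddWalk-traverses g {zero}  {suc zero}    _   _   _  = there (spokes-end (range₂ g))
oddWalk-traverses g {zero}  {suc (suc b)} _   b≤  _  = star-out (s≤s (s≤s z≤n)) b≤
oddWalk-traverses g {suc a} {zero}        a≤  _   _  = star-in (s≤s z≤n) a≤
oddWalk-traverses g {suc a} {suc b}       a≤  b≤  _  = star-rest (tour-traverses g (s≤s z≤n) a≤ (s≤s z≤n) b≤)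

tour-vertices : ∀ g → All (λ a → 1 ≤ a × a ≤ suc g) (1 ∷ tour g)
tour-vertices zero    = (s≤s z≤n , s≤s z≤n) ∷ (s≤s z≤n , s≤s z≤n) ∷ []
tour-vertices (suc g) =
  (s≤s z≤n , s≤s z≤n) ∷ hub ∷
    All-spokes hub inner (hub ∷ All.map (Product.map id m≤n⇒m≤1+n) (tour-vertices g))
  where
  hub : 1 ≤ 2 + g × 2 + g ≤ 2 + g
  hub = s≤s z≤n , ≤-refl
  inner : All (λ a → 1 ≤ a × a ≤ 2 + g) (range₂ g)
  inner = All.map (Product.map <⇒≤ m≤n⇒m≤1+n) (range₂-bounds g)

oddWalk-vertices : ∀ g → All (_≤ suc g) (oddWalk g)
oddWalk-vertices g =
  s≤s z≤n ∷ z≤n ∷ All-spokes z≤n (All.map proj₂ (range₂-bounds g)) (All.map proj₂ (tour-vertices g))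

oddWalk-avoids-00 : ∀ g → Linked NotBothZero (oddWalk g)
oddWalk-avoids-00 g =
  inj₁ (λ ()) ∷ Linked-spokes (All.map (>⇒≢ ∘ <⇒≤ ∘ proj₁) (range₂-bounds g)) (λ ())
                              (nonzero⇒Linked (All.map (>⇒≢ ∘ proj₁) (tour-vertices g)))

length-tour : ∀ g → length (1 ∷ tour g) ≡ suc (suc g * suc g)
length-tour zero    = refl
length-tour (suc g) = begin
  2 + length (spokes (2 + g) (range₂ g) (2 + g ∷ 1 ∷ tour g))
    ≡⟨ cong (2 +_) (length-spokes (2 + g) (range₂ g) _) ⟩
  2 + (length (range₂ g) * 2 + suc (length (1 ∷ tour g)))
    ≡⟨ cong₂ (λ r t → 2 + (r * 2 + suc t)) (length-applyUpTo (2 +_) g) (length-tour g) ⟩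
  2 + (g * 2 + suc (suc (suc g * suc g)))
    ≡⟨ square-step g ⟩
  suc (suc (suc g) * suc (suc g))
    ∎
  where
  open ≡-Reasoning
  square-step : ∀ g → 2 + (g * 2 + suc (suc (suc g * suc g))) ≡ suc (suc (suc g) * suc (suc g))
  square-step = solve-∀

length-oddWalk : ∀ g → length (oddWalk g) ≡ (suc g + 1) * (suc g + 1)
length-oddWalk g = begin
  2 + length (spokes 0 (range₂ g) (1 ∷ tour g))
    ≡⟨ cong (2 +_) (length-spokes 0 (range₂ g) _) ⟩
  2 + (length (range₂ g) * 2 + length (1 ∷ tour g))
    ≡⟨ cong₂ (λ r t → 2 + (r * 2 + t)) (length-applyUpTo (2 +_) g) (length-tour g) ⟩
  2 + (g * 2 + suc (suc g * suc g))
    ≡⟨ square-step g ⟩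
  (suc g + 1) * (suc g + 1)
    ∎
  where
  open ≡-Reasoning
  square-step : ∀ g → 2 + (g * 2 + suc (suc g * suc g)) ≡ (suc g + 1) * (suc g + 1)
  square-step = solve-∀

achievable-even : ∀ {m} g → suc g * suc g ≤ m → (σ : PathSignature m) → Achievable σ (2 * suc g)
achievable-even g fits = arcWalk⇒achievable (KVertex-even⁺ (s≤s z≤n) (s≤s z≤n)) walk
                           (≤-trans (≤-reflexive (length-tour g)) (s≤s fits))
  where
  walk : ArcWalk (2 * suc g) (1 ∷ tour g)
  walk = record
    { vertices  = All.map (uncurry KVertex-even⁺) (tour-vertices g)
    ; avoids-00 = nonzero⇒Linked (All.map (>⇒≢ ∘ proj₁) (tour-vertices g))
    ; traverses = λ (ka , kb , _) → let 1≤a , a≤ = KVertex-even⁻ ka ; 1≤b , b≤ = KVertex-even⁻ kb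
                                    in tour-traverses g 1≤a a≤ 1≤b b≤
    }

achievable-odd : ∀ {m} g → (suc g + 1) * (suc g + 1) ∸ 1 ≤ m → (σ : PathSignature m) →
                 Achievable σ (2 * suc g + 1)
achievable-odd g fits = arcWalk⇒achievable (KVertex-odd⁺ (s≤s z≤n)) walk
                          (≤-trans (≤-reflexive (length-oddWalk g)) (≤-trans (m≤n+m∸n _ 1) (s≤s fits)))
  where
  walk : ArcWalk (2 * suc g + 1) (oddWalk g)
  walk = record
    { vertices  = All.map KVertex-odd⁺ (oddWalk-vertices g)
    ; avoids-00 = oddWalk-avoids-00 g
    ; traverses = λ (ka , kb , nz) → oddWalk-traverses g (KVertex-odd⁻ ka) (KVertex-odd⁻ kb) nz
    }

achievable-one : (σ : PathSignature 0) → Achievable σ 1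
achievable-one σ = σ , path-signatures-equivalent σ σ , (λ _ → col 0 false) , complete
  where
  only-zero : ∀ {a} → KVertex 1 a → a ≡ 0
  only-zero ka = n≤0⇒n≡0 (KVertex-odd⁻ {0} ka)
  complete : Complete 1 σ (λ _ → col 0 false)
  complete = (λ _ → KVertex-odd⁺ {0} z≤n , λ _ → refl)
           , (λ j kj → fzero , sym (only-zero kj))
           , (λ ())
           , (λ a b ka kb a≢b _ → contradiction (trans (only-zero ka) (sym (only-zero kb))) a≢b)
           , (λ a ka a≢0 → contradiction (only-zero ka) a≢0)

one∈FormulaSet : ∀ {n} → FormulaSet n 1
one∈FormulaSet = inj₂ (0 , refl , z≤n)

-- The largest element is never 0, and it is 1 only on the one-vertex path.
largest⇒achievable : ∀ {m k} → IsLargest (FormulaSet (suc m)) k →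
                     (σ : PathSignature m) → Achievable σ k
largest⇒achievable (inj₁ (suc g , refl , fits) , _) = achievable-even g fits
largest⇒achievable (inj₂ (suc g , refl , fits) , _) = achievable-odd g fits
largest⇒achievable {zero} (inj₂ (zero , refl , _) , _) = achievable-one
largest⇒achievable {m} (inj₁ (zero , refl , _) , maximal) =
  contradiction (maximal 1 (one∈FormulaSet {suc m})) λ ()
largest⇒achievable {suc m} (inj₂ (zero , refl , _) , maximal) =
  contradiction (maximal 2 (inj₁ (1 , refl , s≤s z≤n))) λ { (s≤s ()) }

theorem2p14 : (m : ℕ) (σ : PathSignature m) (k : ℕ) →
    IsLargest (FormulaSet (suc m)) k → AchromaticNumberIs σ k
theorem2p14 m σ k largest@(_ , maximal) =
  (maximal 1 (one∈FormulaSet {suc m}) , largest⇒achievable largest σ) ,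
  λ k′ (_ , τ , _ , φ , complete) → maximal k′ (complete⇒FormulaSet τ φ complete)
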